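{- Let $n\ge 2$ and $k$ be positive integers with $k\ge n-1$. Then $\mathit{ghn}(K(2n+k,n))=2$ if $k>2$, and $\mathit{ghn}(K(2n+k,n))=3$ if $k\le 2$.
   Context: For positive integers $n,k$, the Kneser graph $K(2n+k,n)$ has as vertex set all $n$-element subsets of $\{1,\ldots,2n+k\}$, two vertices $u,v$ being adjacent iff $u\cap v=\emptyset$. For vertices $u,v$, $I[u,v]$ is the set of all vertices on some shortest $u$–$v$ path; for $W\subseteq V$, $I[W]=\bigcup_{u,v\in W}I[u,v]$. $W$ is geodetically convex if $I[W]=W$; the geodetic hull $H[W]$ is the smallest geodetically convex set containing $W$; $W$ is a geodetic hull set if $H[W]=V$; the geodetic hull number $\mathit{ghn}(G)$ is the minimum size of a geodetic hull set. -}

module Defs where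

open import Level using (Level; suc; _⊔_)
open import Data.Nat using (ℕ; zero; _+_; _*_; _<_) renaming (suc to sucℕ)
open import Data.Fin.Subset using (Subset; ∣_∣; _∩_; Empty)
open import Data.Product using (Σ; _×_; _,_; proj₁; ∃)
open import Data.List using (List; length)
open import Data.List.Membership.Propositional using (_∈_)
open import Data.List.Relation.Unary.Unique.Propositional using (Unique)
open import Relation.Binary.PropositionalEquality using (_≡_)
open import Relation.Nullary using (¬_)

record Graph : Set₁ where
  field
    V : Set
    E : V → V → Set
open Graph public

module _ (G : Graph) where

  data Walk : V G → V G → ℕ → Set where
    here : ∀ {u} → Walk u u 0
    step : ∀ {u w v ℓ} → E G u w → Walk w v ℓ → Walk u v (sucℕ ℓ)

  data OnWalk (x : V G) : ∀ {u v ℓ} → Walk u v ℓ → Set where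
    on-here : ∀ {ℓ v} {p : Walk x v ℓ} → OnWalk x p
    on-there : ∀ {u w v ℓ} {e : E G u w} {p : Walk w v ℓ} → OnWalk x p → OnWalk x (step e p)

  -- a walk is shortest if there is no shorter u–v walk (shortest walks are paths)
  Shortest : ∀ {u v ℓ} → Walk u v ℓ → Set
  Shortest {u} {v} {ℓ} _ = ∀ ℓ' → ℓ' < ℓ → ¬ Walk u v ℓ'

  Interval : V G → V G → V G → Set
  Interval u v x = Σ ℕ λ ℓ → Σ (Walk u v ℓ) λ p → Shortest p × OnWalk x p

  -- W geodetically convex: I[W] ⊆ W  (W ⊆ I[W] always holds)
  Convex : (V G → Set) → Set
  Convex W = ∀ u v x → W u → W v → Interval u v x → W x

  -- a finite vertex set, given as a duplicate-free list, is a geodetic hull set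
  -- iff its hull (the smallest convex superset) is V, i.e. every convex set
  -- containing it contains every vertex.
  IsHullSet : List (V G) → Set₁
  IsHullSet S = ∀ (C : V G → Set) → Convex C → (∀ x → x ∈ S → C x) → ∀ y → C y

  IsGHN : ℕ → Set₁
  IsGHN g = (Σ (List (V G)) λ S → Unique S × length S ≡ g × IsHullSet S)
          × (∀ S → Unique S → IsHullSet S → ¬ (length S < g))

Kneser : ℕ → ℕ → Graph
Kneser m n = record
  { V = Σ (Subset m) λ p → ∣ p ∣ ≡ n
  ; E = λ u v → Empty (proj₁ u ∩ proj₁ v)
  }

{-# OPTIONS --safe #-}
-- Since 2n + k ≥ 3n − 1, any two vertices of K(2n+k, n) are at distance at most 2, so the
-- interior vertices of geodesics are exactly the "midpoints": common neighbours of two distinct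
-- intersecting n-sets a, b, i.e. n-sets disjoint from a ∪ b.  A vertex set is therefore convex
-- iff it is closed under midpoints.
--
-- Lower bounds: a single vertex is convex; for u ≠ v and k ≤ 2, one of
-- {u, v} ∪ {x : x ∩ (u ∪ v) = ∅} and {x : x ⊆ u ∪ v or x ∩ (u ∪ v) = ∅} is convex, and a
-- vertex meeting u and leaving u ∪ v lies in neither.
--
-- Upper bound for k ≥ 3: a convex set containing two n-subsets of an (n+1)-set R contains every
-- n-set disjoint from R, hence two n-subsets of every (n+1)-set disjoint from R.  When k ≥ 3
-- there is room for an (n+1)-set disjoint from R ∪ R′ whenever R and R′ differ in one point, so
-- the property spreads to all (n+1)-sets, and every vertex avoids one of them.  For k ≤ 2 the
-- hypothesis k ≥ n − 1 leaves K(5,2), K(6,2) and K(8,3), where the hull of three n-sets through a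
-- common (n−1)-set is computed.

module Submission where

open import Defs
open import Data.Nat using (ℕ; zero; suc; _+_; _*_; _∸_; _≤_; _<_; z≤n; s≤s; _<?_)
open import Data.Nat.Tactic.RingSolver using (solve-∀)
open import Data.Nat.Properties
open import Data.Fin using (Fin; zero; suc)
open import Data.Fin.Subset
open import Data.Fin.Subset.Properties
open import Data.Vec using ([]; _∷_; here; there)
open import Data.Bool using (true; false)
import Data.Bool.Properties as Bool
import Data.Vec.Properties as Vec
open import Data.Product using (Σ; _×_; _,_; proj₁; proj₂; uncurry)
open import Data.Sum using (_⊎_; inj₁; inj₂; [_,_]′)
open import Data.Empty using (⊥-elim) renaming (⊥ to False)
open import Relation.Nullary using (Dec; yes; no; ¬_)
open import Relation.Nullary.Decidable using (True; toWitness; map′; ¬?; _×-dec_; _⊎-dec_)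
open import Function using (case_of_)
open import Relation.Binary.Definitions using (DecidableEquality)
open import Relation.Binary.PropositionalEquality
open import Data.List using (List; []; _∷_; length; map; _++_; filter)
open import Data.List.Relation.Unary.Any using (Any; here; there; any?)
open import Data.List.Relation.Unary.All as All using (All; []; _∷_; all?)
open import Data.List.Membership.Propositional using () renaming (_∈_ to _∈ˡ_)
open import Data.List.Membership.Propositional.Properties using (∈-map⁺; ∈-++⁺ˡ; ∈-++⁺ʳ; ∈-filter⁻)
open import Data.List.Relation.Unary.AllPairs using ([]; _∷_)
open import Data.List.Relation.Unary.Unique.Propositional using (Unique)

private variable m : ℕ

∣p∣>0⇒Nonempty : ∀ (p : Subset m) → 0 < ∣ p ∣ → Nonempty p
∣p∣>0⇒Nonempty (true ∷ p) _ = zero , here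
∣p∣>0⇒Nonempty (false ∷ p) pos with ∣p∣>0⇒Nonempty p pos
... | i , i∈p = suc i , there i∈p

x∈p⇒∣p∣>0 : ∀ {p : Subset m} {x} → x ∈ p → 0 < ∣ p ∣
x∈p⇒∣p∣>0 x∈p = ≤-<-trans z≤n (x∈p⇒∣p-x∣<∣p∣ x∈p)

x∈p─q⇒x∉q : ∀ {p q : Subset m} {x} → x ∈ p ─ q → x ∉ q
x∈p─q⇒x∉q {p = true ∷ p} {false ∷ q} here ()
x∈p─q⇒x∉q {p = _ ∷ p} {_ ∷ q} (there x∈p─q) (there x∈q) = x∈p─q⇒x∉q x∈p─q x∈q

x∈p-y⇒x∈p : ∀ {p : Subset m} {x y} → x ∈ p - y → x ∈ p
x∈p-y⇒x∈p {p = p} {y = y} = p─q⊆p p ⁅ y ⁆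

x∈p-y⇒x≢y : ∀ {p : Subset m} {x y} → x ∈ p - y → x ≢ y
x∈p-y⇒x≢y x∈p-y = x∉⁅y⁆⇒x≢y (x∈p─q⇒x∉q x∈p-y)

x∉p-x : ∀ {p : Subset m} {x} → x ∉ p - x
x∉p-x x∈p-x = x∈p-y⇒x≢y x∈p-x refl

∣p∣≡∣p∩q∣+∣p─q∣ : ∀ (p q : Subset m) → ∣ p ∣ ≡ ∣ p ∩ q ∣ + ∣ p ─ q ∣
∣p∣≡∣p∩q∣+∣p─q∣ [] [] = refl
∣p∣≡∣p∩q∣+∣p─q∣ (true ∷ p) (true ∷ q) = cong suc (∣p∣≡∣p∩q∣+∣p─q∣ p q)
∣p∣≡∣p∩q∣+∣p─q∣ (true ∷ p) (false ∷ q) = trans (cong suc (∣p∣≡∣p∩q∣+∣p─q∣ p q)) (sym (+-suc _ _))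
∣p∣≡∣p∩q∣+∣p─q∣ (false ∷ p) (true ∷ q) = ∣p∣≡∣p∩q∣+∣p─q∣ p q
∣p∣≡∣p∩q∣+∣p─q∣ (false ∷ p) (false ∷ q) = ∣p∣≡∣p∩q∣+∣p─q∣ p q

∣p∪q∣+∣p∩q∣≡∣p∣+∣q∣ : ∀ (p q : Subset m) → ∣ p ∪ q ∣ + ∣ p ∩ q ∣ ≡ ∣ p ∣ + ∣ q ∣
∣p∪q∣+∣p∩q∣≡∣p∣+∣q∣ [] [] = refl
∣p∪q∣+∣p∩q∣≡∣p∣+∣q∣ (true ∷ p) (true ∷ q) =
  cong suc (trans (+-suc _ _) (trans (cong suc (∣p∪q∣+∣p∩q∣≡∣p∣+∣q∣ p q)) (sym (+-suc _ _))))
∣p∪q∣+∣p∩q∣≡∣p∣+∣q∣ (true ∷ p) (false ∷ q) = cong suc (∣p∪q∣+∣p∩q∣≡∣p∣+∣q∣ p q)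
∣p∪q∣+∣p∩q∣≡∣p∣+∣q∣ (false ∷ p) (true ∷ q) = trans (cong suc (∣p∪q∣+∣p∩q∣≡∣p∣+∣q∣ p q)) (sym (+-suc _ _))
∣p∪q∣+∣p∩q∣≡∣p∣+∣q∣ (false ∷ p) (false ∷ q) = ∣p∪q∣+∣p∩q∣≡∣p∣+∣q∣ p q

∣∁p∣+∣p∣≡m : ∀ (p : Subset m) → ∣ ∁ p ∣ + ∣ p ∣ ≡ m
∣∁p∣+∣p∣≡m [] = refl
∣∁p∣+∣p∣≡m (true ∷ p) = trans (+-suc _ _) (cong suc (∣∁p∣+∣p∣≡m p))
∣∁p∣+∣p∣≡m (false ∷ p) = cong suc (∣∁p∣+∣p∣≡m p)

suc∣p-x∣≡∣p∣ : ∀ {p : Subset m} {x} → x ∈ p → suc ∣ p - x ∣ ≡ ∣ p ∣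
suc∣p-x∣≡∣p∣ {p = true ∷ p} here = cong (λ q → suc ∣ q ∣) (p─⊥≡p p)
suc∣p-x∣≡∣p∣ {p = true ∷ p} (there x∈p) = cong suc (suc∣p-x∣≡∣p∣ x∈p)
suc∣p-x∣≡∣p∣ {p = false ∷ p} (there x∈p) = suc∣p-x∣≡∣p∣ x∈p

∣p∪⁅x⁆∣≡suc∣p∣ : ∀ {p : Subset m} {x} → x ∉ p → ∣ p ∪ ⁅ x ⁆ ∣ ≡ suc ∣ p ∣
∣p∪⁅x⁆∣≡suc∣p∣ {p = true ∷ p} {zero} x∉p = ⊥-elim (x∉p here)
∣p∪⁅x⁆∣≡suc∣p∣ {p = false ∷ p} {zero} _ = cong (λ q → suc ∣ q ∣) (∪-identityʳ p)
∣p∪⁅x⁆∣≡suc∣p∣ {p = true ∷ p} {suc x} x∉p = cong suc (∣p∪⁅x⁆∣≡suc∣p∣ (λ x∈p → x∉p (there x∈p)))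
∣p∪⁅x⁆∣≡suc∣p∣ {p = false ∷ p} {suc x} x∉p = ∣p∪⁅x⁆∣≡suc∣p∣ (λ x∈p → x∉p (there x∈p))

∣p∣≤s∧t+s≤m⇒t≤∣∁p∣ : ∀ {m} (p : Subset m) {s t} → ∣ p ∣ ≤ s → t + s ≤ m → t ≤ ∣ ∁ p ∣
∣p∣≤s∧t+s≤m⇒t≤∣∁p∣ {m} p {s} {t} ∣p∣≤s t+s≤m = +-cancelʳ-≤ (∣ p ∣) t (∣ ∁ p ∣) (begin
  t + ∣ p ∣      ≤⟨ +-monoʳ-≤ t ∣p∣≤s ⟩
  t + s          ≤⟨ t+s≤m ⟩
  m              ≡⟨ ∣∁p∣+∣p∣≡m p ⟨
  ∣ ∁ p ∣ + ∣ p ∣ ∎)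
  where open ≤-Reasoning

⊆-of-size : ∀ {m} (p : Subset m) {s} → s ≤ ∣ p ∣ → Σ (Subset m) λ q → q ⊆ p × ∣ q ∣ ≡ s
⊆-of-size {m} p {zero} _ = ⊥ , (λ x∈⊥ → ⊥-elim (∉⊥ x∈⊥)) , ∣⊥∣≡0 m
⊆-of-size (true ∷ p) {suc s} (s≤s s≤∣p∣) with ⊆-of-size p s≤∣p∣
... | q , q⊆p , ∣q∣≡s = true ∷ q , s⊆s q⊆p , cong suc ∣q∣≡s
⊆-of-size (false ∷ p) {suc s} s<∣p∣ with ⊆-of-size p s<∣p∣
... | q , q⊆p , ∣q∣≡s = false ∷ q , s⊆s q⊆p , ∣q∣≡s

⊆∧∣p∣≤∣q∣⇒⊇ : ∀ {p q : Subset m} → q ⊆ p → ∣ p ∣ ≤ ∣ q ∣ → p ⊆ q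
⊆∧∣p∣≤∣q∣⇒⊇ {p = p} {q} q⊆p ∣p∣≤∣q∣ {x} x∈p with x ∈? q
... | yes x∈q = x∈q
... | no x∉q = ⊥-elim (<⇒≱ (p⊂q⇒∣p∣<∣q∣ (q⊆p , x , x∈p , x∉q)) ∣p∣≤∣q∣)

Empty-∩⁺ : ∀ {p q : Subset m} → (∀ {x} → x ∈ p → x ∉ q) → Empty (p ∩ q)
Empty-∩⁺ {p = p} {q} disjoint (x , x∈p∩q) = let x∈p , x∈q = x∈p∩q⁻ p q x∈p∩q in disjoint x∈p x∈q

Empty-∩⁻ : ∀ {p q : Subset m} {x} → Empty (p ∩ q) → x ∈ p → x ∉ q
Empty-∩⁻ empty x∈p x∈q = empty (_ , x∈p∩q⁺ (x∈p , x∈q))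

Empty-∩-comm : ∀ {p q : Subset m} → Empty (p ∩ q) → Empty (q ∩ p)
Empty-∩-comm empty = Empty-∩⁺ λ x∈q x∈p → Empty-∩⁻ empty x∈p x∈q

Empty-∩-⊆ʳ : ∀ {p q r : Subset m} → r ⊆ q → Empty (p ∩ q) → Empty (p ∩ r)
Empty-∩-⊆ʳ r⊆q empty = Empty-∩⁺ λ x∈p x∈r → Empty-∩⁻ empty x∈p (r⊆q x∈r)

Empty-∩-⊆ˡ : ∀ {p q r : Subset m} → r ⊆ p → Empty (p ∩ q) → Empty (r ∩ q)
Empty-∩-⊆ˡ r⊆p empty = Empty-∩⁺ λ x∈r x∈q → Empty-∩⁻ empty (r⊆p x∈r) x∈q

Empty-∩⇒⊆∁ : ∀ {p q : Subset m} → Empty (p ∩ q) → p ⊆ ∁ q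
Empty-∩⇒⊆∁ empty x∈p = x∉p⇒x∈∁p (Empty-∩⁻ empty x∈p)

⊆∁⇒Empty-∩ : ∀ {p q : Subset m} → p ⊆ ∁ q → Empty (p ∩ q)
⊆∁⇒Empty-∩ p⊆∁q = Empty-∩⁺ λ x∈p → x∈∁p⇒x∉p (p⊆∁q x∈p)

∣p─q∣≡∣q─p∣ : ∀ (p q : Subset m) → ∣ p ∣ ≡ ∣ q ∣ → ∣ p ─ q ∣ ≡ ∣ q ─ p ∣
∣p─q∣≡∣q─p∣ p q ∣p∣≡∣q∣ = +-cancelˡ-≡ ∣ p ∩ q ∣ _ _ (begin
  ∣ p ∩ q ∣ + ∣ p ─ q ∣   ≡⟨ ∣p∣≡∣p∩q∣+∣p─q∣ p q ⟨
  ∣ p ∣                   ≡⟨ ∣p∣≡∣q∣ ⟩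
  ∣ q ∣                   ≡⟨ ∣p∣≡∣p∩q∣+∣p─q∣ q p ⟩
  ∣ q ∩ p ∣ + ∣ q ─ p ∣   ≡⟨ cong (λ r → ∣ r ∣ + ∣ q ─ p ∣) (∩-comm q p) ⟩
  ∣ p ∩ q ∣ + ∣ q ─ p ∣   ∎)
  where open ≡-Reasoning

two-points : ∀ (R : Subset m) → 2 ≤ ∣ R ∣ → Σ (Fin m) λ i → Σ (Fin m) λ j → i ∈ R × j ∈ R × i ≢ j
two-points R 2≤∣R∣ with ∣p∣>0⇒Nonempty R (≤-trans (s≤s z≤n) 2≤∣R∣)
... | i , i∈R with ∣p∣>0⇒Nonempty (R - i) (≤-pred (subst (2 ≤_) (sym (suc∣p-x∣≡∣p∣ i∈R)) 2≤∣R∣))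
... | j , j∈R-i = i , j , i∈R , x∈p-y⇒x∈p j∈R-i , λ i≡j → x∈p-y⇒x≢y j∈R-i (sym i≡j)

-- Trading a point a ∈ q ─ p for b ∈ p ─ q moves q one step towards p.
exchange : ∀ {p q : Subset m} {b} → ∣ p ∣ ≡ ∣ q ∣ → b ∈ p ─ q →
           Σ (Subset m) λ q′ → ∣ q′ ∣ ≡ ∣ q ∣ × ∣ p ─ q′ ∣ < ∣ p ─ q ∣ × ∣ q′ ∪ q ∣ ≤ suc ∣ q ∣
exchange {p = p} {q} {b} ∣p∣≡∣q∣ b∈p─q
  with ∣p∣>0⇒Nonempty (q ─ p) (subst (0 <_) (∣p─q∣≡∣q─p∣ p q ∣p∣≡∣q∣) (x∈p⇒∣p∣>0 b∈p─q))
... | a , a∈q─p = q′ , ∣q′∣≡∣q∣ , closer , ∣q′∪q∣≤1+∣q∣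
  where
  a∈q : a ∈ q
  a∈q = p─q⊆p q p a∈q─p
  b∉q : b ∉ q
  b∉q = x∈p─q⇒x∉q b∈p─q
  q′ : Subset _
  q′ = (q - a) ∪ ⁅ b ⁆
  q-a⊆q′ : q - a ⊆ q′
  q-a⊆q′ = p⊆p∪q ⁅ b ⁆
  b∈q′ : b ∈ q′
  b∈q′ = q⊆p∪q (q - a) ⁅ b ⁆ (x∈⁅x⁆ b)

  ∣q′∣≡∣q∣ : ∣ q′ ∣ ≡ ∣ q ∣
  ∣q′∣≡∣q∣ = trans (∣p∪⁅x⁆∣≡suc∣p∣ {p = q - a} (λ b∈q-a → b∉q (x∈p-y⇒x∈p b∈q-a))) (suc∣p-x∣≡∣p∣ a∈q)

  p─q′⊆p─q-b : p ─ q′ ⊆ p ─ q - b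
  p─q′⊆p─q-b {x} x∈p─q′ = x∈p∧x≢y⇒x∈p-y (x∈p∧x∉q⇒x∈p─q x∈p x∉q) x≢b
    where
    x∈p : x ∈ p
    x∈p = p─q⊆p p q′ x∈p─q′
    x∉q′ : x ∉ q′
    x∉q′ = x∈p─q⇒x∉q x∈p─q′
    x≢b : x ≢ b
    x≢b refl = x∉q′ b∈q′
    x∉q : x ∉ q
    x∉q x∈q = x∉q′ (q-a⊆q′ (x∈p∧x≢y⇒x∈p-y x∈q λ { refl → x∈p─q⇒x∉q a∈q─p x∈p }))

  closer : ∣ p ─ q′ ∣ < ∣ p ─ q ∣
  closer = ≤-<-trans (p⊆q⇒∣p∣≤∣q∣ p─q′⊆p─q-b) (x∈p⇒∣p-x∣<∣p∣ b∈p─q)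

  q′∪q⊆q∪b : q′ ∪ q ⊆ q ∪ ⁅ b ⁆
  q′∪q⊆q∪b x∈q′∪q with x∈p∪q⁻ q′ q x∈q′∪q
  ... | inj₂ x∈q = p⊆p∪q ⁅ b ⁆ x∈q
  ... | inj₁ x∈q′ with x∈p∪q⁻ (q - a) ⁅ b ⁆ x∈q′
  ...   | inj₁ x∈q-a = p⊆p∪q ⁅ b ⁆ (x∈p-y⇒x∈p x∈q-a)
  ...   | inj₂ x∈⁅b⁆ = q⊆p∪q q ⁅ b ⁆ x∈⁅b⁆

  ∣q′∪q∣≤1+∣q∣ : ∣ q′ ∪ q ∣ ≤ suc ∣ q ∣
  ∣q′∪q∣≤1+∣q∣ = ≤-trans (p⊆q⇒∣p∣≤∣q∣ q′∪q⊆q∪b) (≤-reflexive (∣p∪⁅x⁆∣≡suc∣p∣ b∉q))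

HullSetOfSize : Graph → ℕ → Set₁
HullSetOfSize G g = Σ (List (V G)) λ S → Unique S × length S ≡ g × IsHullSet G S

module _ {m n : ℕ} where

  private G = Kneser m n

  vertex-≡ : ∀ {a b : V G} → proj₁ a ≡ proj₁ b → a ≡ b
  vertex-≡ {p , e} {.p , f} refl = cong (p ,_) (≡-irrelevant e f)

  _≟ᵛ_ : DecidableEquality (V G)
  a ≟ᵛ b = map′ vertex-≡ (cong proj₁) (Vec.≡-dec Bool._≟_ (proj₁ a) (proj₁ b))

  ⊆⇒vertex-≡ : ∀ {a b : V G} → proj₁ a ⊆ proj₁ b → a ≡ b
  ⊆⇒vertex-≡ {a} {b} a⊆b =
    vertex-≡ (⊆-antisym a⊆b (⊆∧∣p∣≤∣q∣⇒⊇ a⊆b (≤-reflexive (trans (proj₂ b) (sym (proj₂ a))))))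

  ≢⇒n<∣a∪b∣ : ∀ {a b : V G} → a ≢ b → n < ∣ proj₁ a ∪ proj₁ b ∣
  ≢⇒n<∣a∪b∣ {a} {b} a≢b with ∣ proj₁ a ∪ proj₁ b ∣ ≤? n
  ... | no ∣a∪b∣≰n = ≰⇒> ∣a∪b∣≰n
  ... | yes ∣a∪b∣≤n = ⊥-elim (a≢b (sym (⊆⇒vertex-≡ (λ x∈b → a∪b⊆a (q⊆p∪q (proj₁ a) (proj₁ b) x∈b)))))
    where
    a∪b⊆a : proj₁ a ∪ proj₁ b ⊆ proj₁ a
    a∪b⊆a = ⊆∧∣p∣≤∣q∣⇒⊇ (p⊆p∪q (proj₁ b)) (≤-trans ∣a∪b∣≤n (≤-reflexive (sym (proj₂ a))))

  ⊆-small⇒≡ : ∀ {A : Subset m} {a b : V G} → ∣ A ∣ ≤ n → proj₁ a ⊆ A → proj₁ b ⊆ A → a ≡ b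
  ⊆-small⇒≡ {b = b} ∣A∣≤n a⊆A b⊆A =
    ⊆⇒vertex-≡ (λ x∈a → ⊆∧∣p∣≤∣q∣⇒⊇ b⊆A (≤-trans ∣A∣≤n (≤-reflexive (sym (proj₂ b)))) (a⊆A x∈a))

  a≢b⊆A⇒A⊆a∪b : ∀ {A : Subset m} {a b : V G} → ∣ A ∣ ≤ suc n → a ≢ b →
                 proj₁ a ⊆ A → proj₁ b ⊆ A → A ⊆ proj₁ a ∪ proj₁ b
  a≢b⊆A⇒A⊆a∪b {A} {a} {b} ∣A∣≤1+n a≢b a⊆A b⊆A =
    ⊆∧∣p∣≤∣q∣⇒⊇ a∪b⊆A (≤-trans ∣A∣≤1+n (≢⇒n<∣a∪b∣ a≢b))
    where
    a∪b⊆A : proj₁ a ∪ proj₁ b ⊆ A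
    a∪b⊆A x∈a∪b with x∈p∪q⁻ (proj₁ a) (proj₁ b) x∈a∪b
    ... | inj₁ x∈a = a⊆A x∈a
    ... | inj₂ x∈b = b⊆A x∈b

  record Midpoint (a b x : V G) : Set where
    constructor midpoint
    field
      distinct : a ≢ b
      meet     : Nonempty (proj₁ a ∩ proj₁ b)
      avoidsˡ  : Empty (proj₁ a ∩ proj₁ x)
      avoidsʳ  : Empty (proj₁ x ∩ proj₁ b)

  midpoint∈interval : ∀ {a b x} → Midpoint a b x → Interval G a b x
  midpoint∈interval {a} {b} (midpoint a≢b meet a∩x x∩b) =
    2 , step a∩x (step x∩b here) , shortest , on-there on-here
    where
    shortest : ∀ ℓ → ℓ < 2 → ¬ Walk G a b ℓ
    shortest zero _ here = a≢b refl
    shortest (suc zero) _ (step a∩b here) = a∩b meet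
    shortest (suc (suc _)) (s≤s (s≤s ())) _

  midpoint-avoids : ∀ {a b x} {A : Subset m} → Midpoint a b x →
                    A ⊆ proj₁ a ∪ proj₁ b → Empty (proj₁ x ∩ A)
  midpoint-avoids {a} {b} (midpoint _ _ a∩x x∩b) A⊆a∪b = Empty-∩⁺ λ y∈x y∈A →
    [ (λ y∈a → Empty-∩⁻ a∩x y∈a y∈x) , Empty-∩⁻ x∩b y∈x ]′ (x∈p∪q⁻ (proj₁ a) (proj₁ b) (A⊆a∪b y∈A))

  diameter≤2 : n + (n + n) ≤ suc m → ∀ (a b : V G) → Σ ℕ λ ℓ → ℓ ≤ 2 × Walk G a b ℓ
  diameter≤2 3n≤1+m a b with a ≟ᵛ b | nonempty? (proj₁ a ∩ proj₁ b)
  ... | yes refl | _ = 0 , z≤n , here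
  ... | no _ | no a∩b = 1 , s≤s z≤n , step a∩b here
  ... | no _ | yes (_ , y∈a∩b) with ⊆-of-size (∁ U) (∣p∣≤s∧t+s≤m⇒t≤∣∁p∣ U ≤-refl n+∣U∣≤m)
    where
    U : Subset m
    U = proj₁ a ∪ proj₁ b
    ∣U∣<n+n : suc ∣ U ∣ ≤ n + n
    ∣U∣<n+n = begin
      suc ∣ U ∣                        ≡⟨ +-comm 1 ∣ U ∣ ⟩
      ∣ U ∣ + 1                        ≤⟨ +-monoʳ-≤ ∣ U ∣ (x∈p⇒∣p∣>0 y∈a∩b) ⟩
      ∣ U ∣ + ∣ proj₁ a ∩ proj₁ b ∣     ≡⟨ ∣p∪q∣+∣p∩q∣≡∣p∣+∣q∣ (proj₁ a) (proj₁ b) ⟩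
      ∣ proj₁ a ∣ + ∣ proj₁ b ∣         ≡⟨ cong₂ _+_ (proj₂ a) (proj₂ b) ⟩
      n + n                            ∎
      where open ≤-Reasoning
    n+∣U∣≤m : n + ∣ U ∣ ≤ m
    n+∣U∣≤m = ≤-pred (≤-trans (≤-reflexive (sym (+-suc n ∣ U ∣))) (≤-trans (+-monoʳ-≤ n ∣U∣<n+n) 3n≤1+m))
  ... | c , c⊆∁U , ∣c∣≡n =
    2 , s≤s (s≤s z≤n) , step {w = c , ∣c∣≡n} (Empty-∩-comm (Empty-∩-⊆ʳ (p⊆p∪q (proj₁ b)) c∩U))
                                            (step (Empty-∩-⊆ʳ (q⊆p∪q (proj₁ a) (proj₁ b)) c∩U) here)
    where
    c∩U : Empty (c ∩ (proj₁ a ∪ proj₁ b))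
    c∩U = ⊆∁⇒Empty-∩ c⊆∁U

  on-walk≤2 : ∀ {a b x ℓ} → ℓ ≤ 2 → (p : Walk G a b ℓ) → Shortest G p → OnWalk G x p →
              x ≡ a ⊎ x ≡ b ⊎ Midpoint a b x
  on-walk≤2 _ here _ on-here = inj₁ refl
  on-walk≤2 _ (step _ here) _ on-here = inj₁ refl
  on-walk≤2 _ (step _ here) _ (on-there on-here) = inj₂ (inj₁ refl)
  on-walk≤2 _ (step _ (step _ here)) _ on-here = inj₁ refl
  on-walk≤2 _ (step _ (step _ here)) _ (on-there (on-there on-here)) = inj₂ (inj₁ refl)
  on-walk≤2 {a} {b} _ (step a∩x (step x∩b here)) shortest (on-there on-here) =
    inj₂ (inj₂ (midpoint a≢b meet a∩x x∩b))
    where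
    a≢b : a ≢ b
    a≢b refl = shortest 0 (s≤s z≤n) here
    meet : Nonempty (proj₁ a ∩ proj₁ b)
    meet with nonempty? (proj₁ a ∩ proj₁ b)
    ... | yes a∩b = a∩b
    ... | no a∩b = ⊥-elim (shortest 1 (s≤s (s≤s z≤n)) (step a∩b here))
  on-walk≤2 (s≤s (s≤s ())) (step _ (step _ (step _ _))) _ _

  interval-shape : n + (n + n) ≤ suc m → ∀ {a b x} → Interval G a b x →
                   x ≡ a ⊎ x ≡ b ⊎ Midpoint a b x
  interval-shape 3n≤1+m {a} {b} (ℓ , p , shortest , x-on-p) with diameter≤2 3n≤1+m a b
  ... | ℓ′ , ℓ′≤2 , q with ℓ′ <? ℓ
  ... | yes ℓ′<ℓ = ⊥-elim (shortest ℓ′ ℓ′<ℓ q)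
  ... | no ℓ′≮ℓ = on-walk≤2 (≤-trans (≮⇒≥ ℓ′≮ℓ) ℓ′≤2) p shortest x-on-p

  midpoint-closed⇒convex : n + (n + n) ≤ suc m → (C : V G → Set) →
                           (∀ {a b x} → C a → C b → Midpoint a b x → C x) → Convex G C
  midpoint-closed⇒convex 3n≤1+m C closed a b x a∈C b∈C x∈I[a,b] with interval-shape 3n≤1+m x∈I[a,b]
  ... | inj₁ refl = a∈C
  ... | inj₂ (inj₁ refl) = b∈C
  ... | inj₂ (inj₂ x-mid) = closed a∈C b∈C x-mid

module _ {m n : ℕ} where

  private G = Kneser m n

  face : (R : Subset m) → ∣ R ∣ ≡ suc n → ∀ {i} → i ∈ R → V G
  face R ∣R∣≡1+n {i} i∈R = R - i , suc-injective (trans (suc∣p-x∣≡∣p∣ i∈R) ∣R∣≡1+n)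

  faces-distinct : ∀ {R : Subset m} (∣R∣≡1+n : ∣ R ∣ ≡ suc n) {i j} (i∈R : i ∈ R) (j∈R : j ∈ R) →
                   i ≢ j → face R ∣R∣≡1+n i∈R ≢ face R ∣R∣≡1+n j∈R
  faces-distinct _ {i} i∈R _ i≢j face≡ =
    x∉p-x (subst (i ∈_) (cong proj₁ (sym face≡)) (x∈p∧x≢y⇒x∈p-y i∈R i≢j))

  faces-midpoint : 2 ≤ n → ∀ {R : Subset m} (∣R∣≡1+n : ∣ R ∣ ≡ suc n) {i j} (i∈R : i ∈ R) (j∈R : j ∈ R) →
                   i ≢ j → ∀ {x : V G} → Empty (proj₁ x ∩ R) →
                   Midpoint (face R ∣R∣≡1+n i∈R) (face R ∣R∣≡1+n j∈R) x
  faces-midpoint 2≤n {R} ∣R∣≡1+n {i} {j} i∈R j∈R i≢j x∩R =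
    midpoint (faces-distinct ∣R∣≡1+n i∈R j∈R i≢j) meet
             (Empty-∩-comm (Empty-∩-⊆ʳ (p─q⊆p R ⁅ i ⁆) x∩R)) (Empty-∩-⊆ʳ (p─q⊆p R ⁅ j ⁆) x∩R)
    where
    j∈R-i : j ∈ R - i
    j∈R-i = x∈p∧x≢y⇒x∈p-y j∈R (λ j≡i → i≢j (sym j≡i))
    ∣R-i-j∣>0 : 0 < ∣ R - i - j ∣
    ∣R-i-j∣>0 = ≤-pred (≤-trans 2≤n (≤-reflexive (sym (suc-injective (begin
      suc (suc ∣ R - i - j ∣)   ≡⟨ cong suc (suc∣p-x∣≡∣p∣ j∈R-i) ⟩
      suc ∣ R - i ∣             ≡⟨ suc∣p-x∣≡∣p∣ i∈R ⟩
      ∣ R ∣                     ≡⟨ ∣R∣≡1+n ⟩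
      suc n                     ∎)))))
      where open ≡-Reasoning
    meet : Nonempty ((R - i) ∩ (R - j))
    meet with ∣p∣>0⇒Nonempty (R - i - j) ∣R-i-j∣>0
    ... | w , w∈R-i-j = w , x∈p∩q⁺ (w∈R-i , x∈p∧x≢y⇒x∈p-y (x∈p-y⇒x∈p w∈R-i) (x∈p-y⇒x≢y w∈R-i-j))
      where
      w∈R-i : w ∈ R - i
      w∈R-i = x∈p-y⇒x∈p w∈R-i-j

  AvoidersIn : (V G → Set) → Subset m → Set
  AvoidersIn C R = ∀ (x : V G) → Empty (proj₁ x ∩ R) → C x

  module HullOfTwoFaces (2≤n : 2 ≤ n) (C : V G → Set) (convex : Convex G C) where

    faces⇒avoiders : ∀ {R : Subset m} (∣R∣≡1+n : ∣ R ∣ ≡ suc n) {i j} (i∈R : i ∈ R) (j∈R : j ∈ R) → i ≢ j →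
                     C (face R ∣R∣≡1+n i∈R) → C (face R ∣R∣≡1+n j∈R) → AvoidersIn C R
    faces⇒avoiders ∣R∣≡1+n i∈R j∈R i≢j Ci Cj x x∩R =
      convex _ _ x Ci Cj (midpoint∈interval (faces-midpoint 2≤n ∣R∣≡1+n i∈R j∈R i≢j x∩R))

    avoiders-⊆ : ∀ {R R′ : Subset m} → AvoidersIn C R → R ⊆ R′ → AvoidersIn C R′
    avoiders-⊆ C⊇R R⊆R′ x x∩R′ = C⊇R x (Empty-∩-⊆ʳ R⊆R′ x∩R′)

    avoiders-disjoint : ∀ {R R′ : Subset m} → AvoidersIn C R → ∣ R′ ∣ ≡ suc n → Empty (R ∩ R′) →
                        AvoidersIn C R′
    avoiders-disjoint {R} {R′} C⊇R ∣R′∣≡1+n R∩R′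
      with two-points R′ (subst (2 ≤_) (sym ∣R′∣≡1+n) (s≤s (≤-trans (s≤s z≤n) 2≤n)))
    ... | i , j , i∈R′ , j∈R′ , i≢j = faces⇒avoiders ∣R′∣≡1+n i∈R′ j∈R′ i≢j (in-C i∈R′) (in-C j∈R′)
      where
      in-C : ∀ {k} (k∈R′ : k ∈ R′) → C (face R′ ∣R′∣≡1+n k∈R′)
      in-C {k} _ = C⊇R _ (Empty-∩-⊆ˡ (p─q⊆p R′ ⁅ k ⁆) (Empty-∩-comm R∩R′))

    module _ (room : suc n + suc (suc n) ≤ m) where

      -- Pass through an (n+1)-set disjoint from both.
      avoiders-near : ∀ {R R′ : Subset m} → AvoidersIn C R → ∣ R′ ∣ ≡ suc n →
                      ∣ R ∪ R′ ∣ ≤ suc (suc n) → AvoidersIn C R′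
      avoiders-near {R} {R′} C⊇R ∣R′∣≡1+n ∣R∪R′∣≤2+n
        with ⊆-of-size (∁ (R ∪ R′)) (∣p∣≤s∧t+s≤m⇒t≤∣∁p∣ (R ∪ R′) ∣R∪R′∣≤2+n room)
      ... | R₁ , R₁⊆∁R∪R′ , ∣R₁∣≡1+n =
        avoiders-disjoint (avoiders-disjoint C⊇R ∣R₁∣≡1+n (Empty-∩-comm (Empty-∩-⊆ʳ (p⊆p∪q R′) R₁∩R∪R′)))
                          ∣R′∣≡1+n (Empty-∩-⊆ʳ (q⊆p∪q R R′) R₁∩R∪R′)
        where
        R₁∩R∪R′ : Empty (R₁ ∩ (R ∪ R′))
        R₁∩R∪R′ = ⊆∁⇒Empty-∩ R₁⊆∁R∪R′

      avoiders-everywhere : ∀ {R₀ : Subset m} → ∣ R₀ ∣ ≡ suc n → AvoidersIn C R₀ →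
                            ∀ {d} (R : Subset m) → ∣ R ∣ ≡ suc n → ∣ R₀ ─ R ∣ ≤ d → AvoidersIn C R
      avoiders-everywhere {R₀} ∣R₀∣≡1+n C⊇R₀ R ∣R∣≡1+n ∣R₀─R∣≤d with nonempty? (R₀ ─ R)
      ... | no R₀─R-empty = avoiders-⊆ C⊇R₀ R₀⊆R
        where
        R₀⊆R : R₀ ⊆ R
        R₀⊆R {x} x∈R₀ with x ∈? R
        ... | yes x∈R = x∈R
        ... | no x∉R = ⊥-elim (R₀─R-empty (x , x∈p∧x∉q⇒x∈p─q x∈R₀ x∉R))
      avoiders-everywhere {R₀} ∣R₀∣≡1+n C⊇R₀ {d} R ∣R∣≡1+n ∣R₀─R∣≤d | yes (b , b∈R₀─R)
        with exchange (trans ∣R₀∣≡1+n (sym ∣R∣≡1+n)) b∈R₀─R | d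
      ... | _ , _ , closer , _ | zero = ⊥-elim (<⇒≱ (≤-<-trans z≤n closer) ∣R₀─R∣≤d)
      ... | R′ , ∣R′∣≡∣R∣ , closer , ∣R′∪R∣≤1+∣R∣ | suc d′ =
        avoiders-near (avoiders-everywhere ∣R₀∣≡1+n C⊇R₀ R′ ∣R′∣≡1+n (≤-pred (≤-trans closer ∣R₀─R∣≤d)))
                      ∣R∣≡1+n (subst (λ s → ∣ R′ ∪ R ∣ ≤ suc s) ∣R∣≡1+n ∣R′∪R∣≤1+∣R∣)
        where
        ∣R′∣≡1+n : ∣ R′ ∣ ≡ suc n
        ∣R′∣≡1+n = trans ∣R′∣≡∣R∣ ∣R∣≡1+n

      avoiders⇒all : ∀ {R₀ : Subset m} → ∣ R₀ ∣ ≡ suc n → AvoidersIn C R₀ → ∀ x → C x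
      avoiders⇒all {R₀} ∣R₀∣≡1+n C⊇R₀ x
        with ⊆-of-size (∁ (proj₁ x)) (∣p∣≤s∧t+s≤m⇒t≤∣∁p∣ (proj₁ x) (≤-reflexive (proj₂ x)) room′)
        where
        room′ : suc n + n ≤ m
        room′ = ≤-trans (+-monoʳ-≤ (suc n) (≤-trans (n≤1+n n) (n≤1+n (suc n)))) room
      ... | R , R⊆∁x , ∣R∣≡1+n =
        avoiders-everywhere ∣R₀∣≡1+n C⊇R₀ R ∣R∣≡1+n ≤-refl x (Empty-∩-comm (⊆∁⇒Empty-∩ R⊆∁x))

  hull-set-of-two : 2 ≤ n → suc n + suc (suc n) ≤ m → HullSetOfSize G 2
  hull-set-of-two 2≤n room
    with ⊆-of-size ⊤ (≤-trans (m≤m+n (suc n) _) (≤-trans room (≤-reflexive (sym (∣⊤∣≡n m)))))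
  ... | R₀ , _ , ∣R₀∣≡1+n
    with two-points R₀ (subst (2 ≤_) (sym ∣R₀∣≡1+n) (s≤s (≤-trans (s≤s z≤n) 2≤n)))
  ... | i , j , i∈R₀ , j∈R₀ , i≢j = u ∷ v ∷ [] , ((u≢v ∷ []) ∷ [] ∷ []) , refl , hull
    where
    u v : V G
    u = face R₀ ∣R₀∣≡1+n i∈R₀
    v = face R₀ ∣R₀∣≡1+n j∈R₀
    u≢v : u ≢ v
    u≢v = faces-distinct ∣R₀∣≡1+n i∈R₀ j∈R₀ i≢j
    hull : IsHullSet G (u ∷ v ∷ [])
    hull C convex u,v∈C = avoiders⇒all room ∣R₀∣≡1+n
      (faces⇒avoiders ∣R₀∣≡1+n i∈R₀ j∈R₀ i≢j (u,v∈C u (here refl)) (u,v∈C v (there (here refl))))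
      where open HullOfTwoFaces 2≤n C convex

module NoSmallHullSets {m n : ℕ} (2≤n : 2 ≤ n) (2n<m : n + n < m) (3n≤1+m : n + (n + n) ≤ suc m) where

  private G = Kneser m n

  escaping-vertex : ∀ (u v : V G) → Σ (V G) λ y →
                    Σ (Fin m) (λ l → l ∈ proj₁ y × l ∉ proj₁ u ∪ proj₁ v) × Nonempty (proj₁ y ∩ proj₁ u)
  escaping-vertex u v with ∣p∣>0⇒Nonempty (∁ U) (∣p∣≤s∧t+s≤m⇒t≤∣∁p∣ U ∣U∣≤n+n 2n<m)
                         | two-points (proj₁ u) (subst (2 ≤_) (sym (proj₂ u)) 2≤n)
    where
    U : Subset m
    U = proj₁ u ∪ proj₁ v
    ∣U∣≤n+n : ∣ U ∣ ≤ n + n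
    ∣U∣≤n+n = ≤-trans (m≤m+n ∣ U ∣ _) (≤-reflexive
      (trans (∣p∪q∣+∣p∩q∣≡∣p∣+∣q∣ (proj₁ u) (proj₁ v)) (cong₂ _+_ (proj₂ u) (proj₂ v))))
  ... | l , l∈∁U | i , w , i∈u , w∈u , i≢w =
    y , (l , q⊆p∪q (proj₁ u - i) ⁅ l ⁆ (x∈⁅x⁆ l) , x∈∁p⇒x∉p l∈∁U) , (w , x∈p∩q⁺ (p⊆p∪q ⁅ l ⁆ w∈u-i , w∈u))
    where
    l∉u-i : l ∉ proj₁ u - i
    l∉u-i l∈u-i = x∈∁p⇒x∉p l∈∁U (p⊆p∪q (proj₁ v) (x∈p-y⇒x∈p l∈u-i))
    y : V G
    y = (proj₁ u - i) ∪ ⁅ l ⁆ , trans (∣p∪⁅x⁆∣≡suc∣p∣ l∉u-i) (trans (suc∣p-x∣≡∣p∣ i∈u) (proj₂ u))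
    w∈u-i : w ∈ proj₁ u - i
    w∈u-i = x∈p∧x≢y⇒x∈p-y w∈u (λ w≡i → i≢w (sym w≡i))

  no-hull-set-of-size-0 : ¬ IsHullSet G []
  no-hull-set-of-size-0 hull
    with ⊆-of-size ⊤ (≤-trans (m≤m+n n n) (≤-trans (n≤1+n _) (≤-trans 2n<m (≤-reflexive (sym (∣⊤∣≡n m))))))
  ... | p , _ , ∣p∣≡n = hull (λ _ → False) (λ _ _ _ ()) (λ _ ()) (p , ∣p∣≡n)

  no-hull-set-of-size-1 : ∀ u → ¬ IsHullSet G (u ∷ [])
  no-hull-set-of-size-1 u hull with escaping-vertex u u
  ... | y , (l , l∈y , l∉u∪u) , _ =
    l∉u∪u (p⊆p∪q (proj₁ u) (subst (λ z → l ∈ proj₁ z) y≡u l∈y))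
    where
    convex : Convex G (_≡ u)
    convex = midpoint-closed⇒convex 3n≤1+m (_≡ u) λ { refl refl mid → ⊥-elim (Midpoint.distinct mid refl) }
    y≡u : y ≡ u
    y≡u = hull (_≡ u) convex (λ { _ (here refl) → refl }) y

  PairOrAvoider : V G → V G → V G → Set
  PairOrAvoider u v z = (z ≡ u ⊎ z ≡ v) ⊎ Empty (proj₁ z ∩ (proj₁ u ∪ proj₁ v))

  pair-or-avoiders-convex : ∀ (u v : V G) → ∣ ∁ (proj₁ u ∪ proj₁ v) ∣ ≤ n → Convex G (PairOrAvoider u v)
  pair-or-avoiders-convex u v ∣∁U∣≤n = midpoint-closed⇒convex 3n≤1+m (PairOrAvoider u v) closed
    where
    U : Subset m
    U = proj₁ u ∪ proj₁ v
    ⊆U : ∀ {a} → a ≡ u ⊎ a ≡ v → proj₁ a ⊆ U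
    ⊆U (inj₁ refl) = p⊆p∪q (proj₁ v)
    ⊆U (inj₂ refl) = q⊆p∪q (proj₁ u) (proj₁ v)
    covers : ∀ {a b} → a ≡ u ⊎ a ≡ v → b ≡ u ⊎ b ≡ v → a ≢ b → U ⊆ proj₁ a ∪ proj₁ b
    covers (inj₁ refl) (inj₂ refl) _ = λ x∈U → x∈U
    covers (inj₂ refl) (inj₁ refl) _ = λ x∈U → subst (_ ∈_) (∪-comm (proj₁ u) (proj₁ v)) x∈U
    covers (inj₁ refl) (inj₁ refl) a≢b = ⊥-elim (a≢b refl)
    covers (inj₂ refl) (inj₂ refl) a≢b = ⊥-elim (a≢b refl)
    closed : ∀ {a b x} → PairOrAvoider u v a → PairOrAvoider u v b → Midpoint a b x → PairOrAvoider u v x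
    closed (inj₁ a∈uv) (inj₁ b∈uv) mid =
      inj₂ (midpoint-avoids mid (covers a∈uv b∈uv (Midpoint.distinct mid)))
    closed (inj₂ a∩U) (inj₂ b∩U) mid =
      ⊥-elim (Midpoint.distinct mid (⊆-small⇒≡ ∣∁U∣≤n (Empty-∩⇒⊆∁ a∩U) (Empty-∩⇒⊆∁ b∩U)))
    closed (inj₁ a∈uv) (inj₂ b∩U) (midpoint _ (_ , z∈a∩b) _ _) =
      let z∈a , z∈b = x∈p∩q⁻ _ _ z∈a∩b in ⊥-elim (Empty-∩⁻ b∩U z∈b (⊆U a∈uv z∈a))
    closed (inj₂ a∩U) (inj₁ b∈uv) (midpoint _ (_ , z∈a∩b) _ _) =
      let z∈a , z∈b = x∈p∩q⁻ _ _ z∈a∩b in ⊥-elim (Empty-∩⁻ a∩U z∈a (⊆U b∈uv z∈b))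

  OnOneSide : Subset m → V G → Set
  OnOneSide A z = proj₁ z ⊆ A ⊎ proj₁ z ⊆ ∁ A

  sides-convex : ∀ (A : Subset m) → ∣ A ∣ ≤ suc n → ∣ ∁ A ∣ ≤ suc n → Convex G (OnOneSide A)
  sides-convex A ∣A∣≤1+n ∣∁A∣≤1+n = midpoint-closed⇒convex 3n≤1+m (OnOneSide A) closed
    where
    closed : ∀ {a b x} → OnOneSide A a → OnOneSide A b → Midpoint a b x → OnOneSide A x
    closed (inj₁ a⊆A) (inj₁ b⊆A) mid =
      inj₂ (Empty-∩⇒⊆∁ (midpoint-avoids mid (a≢b⊆A⇒A⊆a∪b ∣A∣≤1+n (Midpoint.distinct mid) a⊆A b⊆A)))
    closed {x = x} (inj₂ a⊆∁A) (inj₂ b⊆∁A) mid = inj₁ λ y∈x → x∉∁p⇒x∈p (Empty-∩⁻ x∩∁A y∈x)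
      where
      x∩∁A : Empty (proj₁ x ∩ ∁ A)
      x∩∁A = midpoint-avoids mid (a≢b⊆A⇒A⊆a∪b ∣∁A∣≤1+n (Midpoint.distinct mid) a⊆∁A b⊆∁A)
    closed (inj₁ a⊆A) (inj₂ b⊆∁A) (midpoint _ (_ , z∈a∩b) _ _) =
      let z∈a , z∈b = x∈p∩q⁻ _ _ z∈a∩b in ⊥-elim (x∈∁p⇒x∉p (b⊆∁A z∈b) (a⊆A z∈a))
    closed (inj₂ a⊆∁A) (inj₁ b⊆A) (midpoint _ (_ , z∈a∩b) _ _) =
      let z∈a , z∈b = x∈p∩q⁻ _ _ z∈a∩b in ⊥-elim (x∈∁p⇒x∉p (a⊆∁A z∈a) (b⊆A z∈b))

  balanced : m ≤ suc n + suc n → ∀ {A : Subset m} → n < ∣ A ∣ → n < ∣ ∁ A ∣ →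
             ∣ A ∣ ≤ suc n × ∣ ∁ A ∣ ≤ suc n
  balanced m≤2+2n {A} n<∣A∣ n<∣∁A∣ =
    +-cancelˡ-≤ (suc n) _ _ (≤-trans (+-monoˡ-≤ ∣ A ∣ n<∣∁A∣) ∣∁A∣+∣A∣≤2+2n) ,
    +-cancelʳ-≤ (suc n) _ _ (≤-trans (+-monoʳ-≤ ∣ ∁ A ∣ n<∣A∣) ∣∁A∣+∣A∣≤2+2n)
    where
    ∣∁A∣+∣A∣≤2+2n : ∣ ∁ A ∣ + ∣ A ∣ ≤ suc n + suc n
    ∣∁A∣+∣A∣≤2+2n = ≤-trans (≤-reflexive (∣∁p∣+∣p∣≡m A)) m≤2+2n

  no-hull-set-of-size-2 : m ≤ suc n + suc n → ∀ {u v} → u ≢ v → ¬ IsHullSet G (u ∷ v ∷ [])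
  no-hull-set-of-size-2 m≤2+2n {u} {v} u≢v hull with escaping-vertex u v | ∣ ∁ U ∣ ≤? n
    where
    U : Subset m
    U = proj₁ u ∪ proj₁ v
  ... | y , (l , l∈y , l∉U) , (w , w∈y∩u) | yes ∣∁U∣≤n
    with hull (PairOrAvoider u v) (pair-or-avoiders-convex u v ∣∁U∣≤n)
              (λ { _ (here refl) → inj₁ (inj₁ refl) ; _ (there (here refl)) → inj₁ (inj₂ refl) }) y
  ...   | inj₁ (inj₁ refl) = l∉U (p⊆p∪q (proj₁ v) l∈y)
  ...   | inj₁ (inj₂ refl) = l∉U (q⊆p∪q (proj₁ u) (proj₁ v) l∈y)
  ...   | inj₂ y∩U = let w∈y , w∈u = x∈p∩q⁻ _ _ w∈y∩u in Empty-∩⁻ y∩U w∈y (p⊆p∪q (proj₁ v) w∈u)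
  no-hull-set-of-size-2 m≤2+2n {u} {v} u≢v hull
    | y , (l , l∈y , l∉U) , (w , w∈y∩u) | no ∣∁U∣≰n
    with hull (OnOneSide U) (uncurry (sides-convex U) (balanced m≤2+2n {U} (≢⇒n<∣a∪b∣ u≢v) (≰⇒> ∣∁U∣≰n)))
              (λ { _ (here refl) → inj₁ (p⊆p∪q (proj₁ v))
                 ; _ (there (here refl)) → inj₁ (q⊆p∪q (proj₁ u) (proj₁ v)) }) y
    where
    U : Subset m
    U = proj₁ u ∪ proj₁ v
  ...   | inj₁ y⊆U = l∉U (y⊆U l∈y)
  ...   | inj₂ y⊆∁U = let w∈y , w∈u = x∈p∩q⁻ _ _ w∈y∩u in x∈∁p⇒x∉p (y⊆∁U w∈y) (p⊆p∪q (proj₁ v) w∈u)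

  no-hull-set-below-2 : ∀ S → IsHullSet G S → ¬ (length S < 2)
  no-hull-set-below-2 [] hull _ = no-hull-set-of-size-0 hull
  no-hull-set-below-2 (u ∷ []) hull _ = no-hull-set-of-size-1 u hull
  no-hull-set-below-2 (_ ∷ _ ∷ _) _ (s≤s (s≤s ()))

  no-hull-set-below-3 : m ≤ suc n + suc n → ∀ S → Unique S → IsHullSet G S → ¬ (length S < 3)
  no-hull-set-below-3 m≤2+2n (_ ∷ _ ∷ []) ((u≢v ∷ []) ∷ _) hull _ = no-hull-set-of-size-2 m≤2+2n u≢v hull
  no-hull-set-below-3 _ (_ ∷ _ ∷ _ ∷ _) _ _ (s≤s (s≤s (s≤s ())))
  no-hull-set-below-3 _ [] _ hull _ = no-hull-set-of-size-0 hull
  no-hull-set-below-3 _ (u ∷ []) _ hull _ = no-hull-set-of-size-1 u hull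

insideᵛ : ∀ {m n} → V (Kneser m n) → V (Kneser (suc m) (suc n))
insideᵛ (p , ∣p∣≡n) = inside ∷ p , cong suc ∣p∣≡n

outsideᵛ : ∀ {m n} → V (Kneser m n) → V (Kneser (suc m) n)
outsideᵛ (p , ∣p∣≡n) = outside ∷ p , ∣p∣≡n

vertices : ∀ m n → List (V (Kneser m n))
vertices zero zero = ([] , refl) ∷ []
vertices zero (suc n) = []
vertices (suc m) zero = map outsideᵛ (vertices m zero)
vertices (suc m) (suc n) = map insideᵛ (vertices m n) ++ map outsideᵛ (vertices m (suc n))

∈-vertices : ∀ {m n} (x : V (Kneser m n)) → x ∈ˡ vertices m n
∈-vertices {zero} {zero} ([] , refl) = here refl
∈-vertices {suc m} {zero} (false ∷ p , ∣p∣≡0) = ∈-map⁺ outsideᵛ (∈-vertices (p , ∣p∣≡0))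
∈-vertices {suc m} {suc n} (true ∷ p , ∣p∣≡n) = subst (_∈ˡ vertices (suc m) (suc n)) (vertex-≡ refl)
  (∈-++⁺ˡ (∈-map⁺ insideᵛ (∈-vertices (p , suc-injective ∣p∣≡n))))
∈-vertices {suc m} {suc n} (false ∷ p , ∣p∣≡1+n) =
  ∈-++⁺ʳ (map insideᵛ (vertices m n)) (∈-map⁺ outsideᵛ (∈-vertices (p , ∣p∣≡1+n)))

module _ {m n : ℕ} where

  private G = Kneser m n
  open import Data.List.Membership.DecPropositional (_≟ᵛ_ {m} {n}) using () renaming (_∈?_ to _∈ˡ?_)

  midpoint? : ∀ (a b x : V G) → Dec (Midpoint a b x)
  midpoint? a b x = map′ (λ (a∩x , x∩b , a≢b , meet) → midpoint a≢b meet a∩x x∩b)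
                         (λ (midpoint a≢b meet a∩x x∩b) → a∩x , x∩b , a≢b , meet)
                         (¬? (nonempty? (proj₁ a ∩ proj₁ x)) ×-dec ¬? (nonempty? (proj₁ x ∩ proj₁ b))
                           ×-dec ¬? (a ≟ᵛ b) ×-dec nonempty? (proj₁ a ∩ proj₁ b))

  -- The first conjunct is redundant; it lets the decision below reject a before scanning for b.
  Spanned : List (V G) → V G → Set
  Spanned S x = Any (λ a → Empty (proj₁ a ∩ proj₁ x) × Any (λ b → Midpoint a b x) S) S

  grows? : ∀ (S : List (V G)) x → Dec (x ∈ˡ S ⊎ Spanned S x)
  grows? S x =
    x ∈ˡ? S ⊎-dec any? (λ a → ¬? (nonempty? (proj₁ a ∩ proj₁ x)) ×-dec any? (λ b → midpoint? a b x) S) S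

  grow : List (V G) → List (V G)
  grow S = filter (grows? S) (vertices m n)

  close : ℕ → List (V G) → List (V G)
  close zero S = S
  close (suc rounds) S = close rounds (grow S)

  module _ (C : V G → Set) (convex : Convex G C) where

    grow-sound : ∀ {S} → All C S → All C (grow S)
    grow-sound {S} C⊇S = All.tabulate λ x∈grow →
      case proj₂ (∈-filter⁻ (grows? S) {xs = vertices m n} x∈grow) of λ where
      (inj₁ x∈S) → All.lookup C⊇S x∈S
      (inj₂ spanned) →
        let Ca , _ , inner = All.lookupAny C⊇S spanned
            Cb , mid = All.lookupAny C⊇S inner
        in convex _ _ _ Ca Cb (midpoint∈interval mid)

    close-sound : ∀ rounds {S} → All C S → All C (close rounds S)
    close-sound zero C⊇S = C⊇S
    close-sound (suc rounds) C⊇S = close-sound rounds (grow-sound C⊇S)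

  closure-hull : ∀ rounds S → True (all? (_∈ˡ? close rounds S) (vertices m n)) → IsHullSet G S
  closure-hull rounds S complete C convex C⊇S x =
    All.lookup (close-sound C convex rounds (All.tabulate (C⊇S _)))
               (All.lookup (toWitness complete) (∈-vertices x))

K52-hull-set : HullSetOfSize (Kneser 5 2) 3
K52-hull-set = S , ((λ ()) ∷ (λ ()) ∷ []) ∷ ((λ ()) ∷ []) ∷ [] ∷ [] , refl , closure-hull 3 S _
  where
  S : List (V (Kneser 5 2))
  S = (true ∷ true ∷ false ∷ false ∷ false ∷ [] , refl)
    ∷ (true ∷ false ∷ true ∷ false ∷ false ∷ [] , refl)
    ∷ (true ∷ false ∷ false ∷ true ∷ false ∷ [] , refl) ∷ []

K62-hull-set : HullSetOfSize (Kneser 6 2) 3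
K62-hull-set = S , ((λ ()) ∷ (λ ()) ∷ []) ∷ ((λ ()) ∷ []) ∷ [] ∷ [] , refl , closure-hull 3 S _
  where
  S : List (V (Kneser 6 2))
  S = (true ∷ true ∷ false ∷ false ∷ false ∷ false ∷ [] , refl)
    ∷ (true ∷ false ∷ true ∷ false ∷ false ∷ false ∷ [] , refl)
    ∷ (true ∷ false ∷ false ∷ true ∷ false ∷ false ∷ [] , refl) ∷ []

K83-hull-set : HullSetOfSize (Kneser 8 3) 3
K83-hull-set = S , ((λ ()) ∷ (λ ()) ∷ []) ∷ ((λ ()) ∷ []) ∷ [] ∷ [] , refl , closure-hull 3 S _
  where
  S : List (V (Kneser 8 3))
  S = (true ∷ true ∷ true ∷ false ∷ false ∷ false ∷ false ∷ false ∷ [] , refl)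
    ∷ (true ∷ true ∷ false ∷ true ∷ false ∷ false ∷ false ∷ false ∷ [] , refl)
    ∷ (true ∷ true ∷ false ∷ false ∷ true ∷ false ∷ false ∷ false ∷ [] , refl) ∷ []

private
  2n+k≡n+n+k : ∀ n k → 2 * n + k ≡ n + n + k
  2n+k≡n+n+k = solve-∀

  3n≡n+n+n : ∀ n → n + (n + n) ≡ n + n + n
  3n≡n+n+n = solve-∀

  2n+3≡n+n+3 : ∀ n → suc n + suc (suc n) ≡ n + n + 3
  2n+3≡n+n+3 = solve-∀

  2n+2≡n+n+2 : ∀ n → suc n + suc n ≡ n + n + 2
  2n+2≡n+n+2 = solve-∀

module _ (n k : ℕ) where

  open ≤-Reasoning

  n+n<2n+k : 1 ≤ k → n + n < 2 * n + k
  n+n<2n+k 1≤k = begin-strict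
    n + n       <⟨ m<m+n (n + n) 1≤k ⟩
    n + n + k   ≡⟨ 2n+k≡n+n+k n k ⟨
    2 * n + k   ∎

  3n≤1+2n+k : n ∸ 1 ≤ k → n + (n + n) ≤ suc (2 * n + k)
  3n≤1+2n+k n∸1≤k = begin
    n + (n + n)       ≡⟨ 3n≡n+n+n n ⟩
    n + n + n         ≤⟨ +-monoʳ-≤ (n + n) (n≤1+k n n∸1≤k) ⟩
    n + n + suc k     ≡⟨ +-suc (n + n) k ⟩
    suc (n + n + k)   ≡⟨ cong suc (2n+k≡n+n+k n k) ⟨
    suc (2 * n + k)   ∎
    where
    n≤1+k : ∀ n → n ∸ 1 ≤ k → n ≤ suc k
    n≤1+k zero _ = z≤n
    n≤1+k (suc n) n≤k = s≤s n≤k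

  2n+3≤2n+k : 2 < k → suc n + suc (suc n) ≤ 2 * n + k
  2n+3≤2n+k 2<k = begin
    suc n + suc (suc n)   ≡⟨ 2n+3≡n+n+3 n ⟩
    n + n + 3             ≤⟨ +-monoʳ-≤ (n + n) 2<k ⟩
    n + n + k             ≡⟨ 2n+k≡n+n+k n k ⟨
    2 * n + k             ∎

  2n+k≤2n+2 : k ≤ 2 → 2 * n + k ≤ suc n + suc n
  2n+k≤2n+2 k≤2 = begin
    2 * n + k       ≡⟨ 2n+k≡n+n+k n k ⟩
    n + n + k       ≤⟨ +-monoʳ-≤ (n + n) k≤2 ⟩
    n + n + 2       ≡⟨ 2n+2≡n+n+2 n ⟨
    suc n + suc n   ∎

hull-set-of-three : ∀ n k → 2 ≤ n → 1 ≤ k → n ∸ 1 ≤ k → k ≤ 2 → HullSetOfSize (Kneser (2 * n + k) n) 3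
hull-set-of-three 2 1 _ _ _ _ = K52-hull-set
hull-set-of-three 2 2 _ _ _ _ = K62-hull-set
hull-set-of-three 3 2 _ _ _ _ = K83-hull-set
hull-set-of-three 3 1 _ _ (s≤s ()) _
hull-set-of-three (suc (suc (suc (suc _)))) 1 _ _ (s≤s ()) _
hull-set-of-three (suc (suc (suc (suc _)))) 2 _ _ (s≤s (s≤s ())) _
hull-set-of-three _ (suc (suc (suc _))) _ _ _ (s≤s (s≤s ()))
hull-set-of-three _ 0 _ () _ _
hull-set-of-three 0 _ () _ _ _
hull-set-of-three 1 _ (s≤s ()) _ _ _

theorem10 : ∀ (n k : ℕ) → 2 ≤ n → 1 ≤ k → n ∸ 1 ≤ k →
    (2 < k → IsGHN (Kneser (2 * n + k) n) 2) × (k ≤ 2 → IsGHN (Kneser (2 * n + k) n) 3)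
theorem10 n k 2≤n 1≤k n∸1≤k =
  (λ 2<k → hull-set-of-two 2≤n (2n+3≤2n+k n k 2<k) , λ S _ → no-hull-set-below-2 S) ,
  (λ k≤2 → hull-set-of-three n k 2≤n 1≤k n∸1≤k k≤2 , no-hull-set-below-3 (2n+k≤2n+2 n k k≤2))
  where open NoSmallHullSets 2≤n (n+n<2n+k n k 1≤k) (3n≤1+2n+k n k n∸1≤k)
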